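{- Let $n \ge 1$, let $S_1, \ldots, S_n$ be finite sets with $|S_k| \ge 2$ for each $k$, let $Q = S_1 \times \cdots \times S_n$, let $\delta \in [0,1/2]$, and let $\mathcal{A}$ be a collection of hyperplanes in $Q$, no two of which are parallel. Let $\alpha_k$ and $\mathbb{P}_k$ be defined from $\mathcal{A}$ and $\delta$ as in the context, and for $J \subseteq \{1,\ldots,n\}$ let $\nu(J) = \prod_{j \in J} \frac{1}{(1-\delta)|S_j|}$. Then for each $1 \le k \le n$, $$\mathbb{E}_{k-1}\big[\alpha_k(x)^2\big] \le \frac{1}{|S_k|^2} \sum_{F_1, F_2 \subseteq \{1,\ldots,k-1\}} \nu(F_1 \cup F_2),$$ where the sum is over all ordered pairs of subsets $F_1, F_2$ of $\{1,\ldots,k-1\}$.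
   Context: For $0 \le k \le n$ let $Q_k = S_1 \times \cdots \times S_k$ ($Q_0$ is a one-point set). A hyperplane in $Q$ is a set $A = Y_1 \times \cdots \times Y_n$ where each $Y_i$ is either $S_i$ or a single element of $S_i$; its set of fixed coordinates is $F(A) = \{k : Y_k \ne S_k\}$. Two hyperplanes $A, A'$ are parallel if $F(A) = F(A')$. A subset $X \subseteq Q_k$ is identified with $X \times S_{k+1} \times \cdots \times S_n \subseteq Q$. For $1 \le k \le n$ let $\mathcal{A}_k = \{A \in \mathcal{A} : \max F(A) = k\}$ and $B_k = \bigcup_{A \in \mathcal{A}_k} A$, regarded as a subset of $Q_k$. Write elements of $Q_k$ as pairs $(x,y)$ with $x \in Q_{k-1}$, $y \in S_k$. For $x \in Q_{k-1}$ set $\alpha_k(x) = |\{y \in S_k : (x,y) \in B_k\}| / |S_k|$. Define probability measures $\mathbb{P}_k$ on $Q_k$ recursively: $\mathbb{P}_0$ is the unique probability measure on $Q_0$, and for $1 \le k \le n$ and $(x,y) \in Q_k$, $$\mathbb{P}_k(x,y) = \max\Big\{0, \frac{\alpha_k(x) - \delta}{\alpha_k(x)(1-\delta)}\Big\} \cdot \frac{\mathbb{P}_{k-1}(x)}{|S_k|} \text{ if } (x,y) \in B_k,$$ $$\mathbb{P}_k(x,y) = \min\Big\{\frac{1}{1-\alpha_k(x)}, \frac{1}{1-\delta}\Big\} \cdot \frac{\mathbb{P}_{k-1}(x)}{|S_k|} \text{ if } (x,y) \notin B_k.$$ Each $\mathbb{P}_k$ is extended to a probability measure on $Q$ uniformly.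 $\mathbb{E}_{k-1}[\alpha_k(x)^2]$ denotes $\sum_{x \in Q_{k-1}} \alpha_k(x)^2 \, \mathbb{P}_{k-1}(x)$.
   Formalization: The parameter δ is rational, ranging over the rational numbers in $[0,1/2]$. -}

module Defs where

open import Data.Bool using (Bool; true; false; if_then_else_; _∧_; _∨_)
open import Data.Nat as ℕ using (ℕ; zero; suc; _≡ᵇ_; _<ᵇ_)
open import Data.Fin as Fin using (Fin; toℕ)
open import Data.Fin.Subset using (Subset; _∪_)
open import Data.Vec using (Vec; []; _∷_; lookup)
open import Data.Maybe using (Maybe; just; nothing; is-just)
open import Data.Unit using (⊤; tt)
open import Data.Product using (_×_; _,_)
open import Data.List using (List; allFin)
open import Data.Bool.ListAction using (all; any)
open import Data.Rational using (ℚ; 0ℚ; 1ℚ; _+_; _*_; _-_; _÷_; _⊔_; _⊓_; ≢-nonZero)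
import Data.Rational as ℚ
open import Data.Rational.Properties using (_≟_)
open import Data.Integer using (+_)
open import Relation.Nullary using (yes; no; does)
open import Relation.Binary.PropositionalEquality using (_≡_; refl)

-- Total division on ℚ (returns 0 when dividing by 0; this never happens
-- in the places it is used below).
_÷'_ : ℚ → ℚ → ℚ
p ÷' q with q ≟ 0ℚ
... | yes _ = 0ℚ
... | no q≢0 = _÷_ p q {{≢-nonZero q≢0}}

ℕ→ℚ : ℕ → ℚ
ℕ→ℚ m = (+ m) ℚ./ 1

sumFin : (m : ℕ) → (Fin m → ℚ) → ℚ
sumFin zero    f = 0ℚ
sumFin (suc m) f = f Fin.zero + sumFin m (λ i → f (Fin.suc i))

prodFin : (m : ℕ) → (Fin m → ℚ) → ℚ
prodFin zero    f = 1ℚ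
prodFin (suc m) f = f Fin.zero * prodFin m (λ i → f (Fin.suc i))

sumSubsets : (k : ℕ) → (Subset k → ℚ) → ℚ
sumSubsets zero    f = f []
sumSubsets (suc k) f = sumSubsets k (λ v → f (false ∷ v))
                     + sumSubsets k (λ v → f (true ∷ v))

-- Coordinates are 0-based: S_{j+1} in the paper is Fin (s j).
module _ (s : ℕ → ℕ) where

  -- Q_k = S_1 × ... × S_k, with Q_{k+1} = Q_k × S_{k+1} (pairs (x , y))
  Pt : ℕ → Set
  Pt zero    = ⊤
  Pt (suc k) = Pt k × Fin (s k)

  coord : (k : ℕ) → Pt k → (j : ℕ) → Maybe (Fin (s j))
  coord zero    tt      j = nothing
  coord (suc k) (x , y) j with j ℕ.≟ k
  ... | yes refl = just y
  ... | no _     = coord k x j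

  sumPt : (k : ℕ) → (Pt k → ℚ) → ℚ
  sumPt zero    f = f tt
  sumPt (suc k) f = sumPt k (λ x → sumFin (s k) (λ y → f (x , y)))

  -- A hyperplane in Q = S_1 × ... × S_n : coordinate j is either the whole
  -- S_{j+1} (nothing) or a single element (just a).
  Hyp : ℕ → Set
  Hyp n = (j : Fin n) → Maybe (Fin (s (toℕ j)))

  Parallel : {n : ℕ} → Hyp n → Hyp n → Set
  Parallel {n} A A' = (j : Fin n) → is-just (A j) ≡ is-just (A' j)

  module _ (n : ℕ) (δ : ℚ) (𝒜 : List (Hyp n)) where

    -- max F(A) = k+1 in the paper's 1-based indexing, i.e. 0-based coordinate k
    -- is fixed and all coordinates > k are free
    inLevel : ℕ → Hyp n → Bool
    inLevel k A = all (λ j → if toℕ j ≡ᵇ k then is-just (A j)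
                             else if k <ᵇ toℕ j then Data.Bool.not (is-just (A j))
                             else true) (allFin n)
      where import Data.Bool

    agree : {m : ℕ} → Maybe (Fin m) → Maybe (Fin m) → Bool
    agree nothing  _        = true
    agree (just a) (just b) = does (a Fin.≟ b)
    agree (just a) nothing  = false

    -- z ∈ Q_{k+1} lies in A (A ∈ 𝒜_{k+1} regarded as a subset of Q_{k+1})
    contains : (k : ℕ) → Hyp n → Pt (suc k) → Bool
    contains k A z = all (λ j → if toℕ j <ᵇ suc k then agree (A j) (coord (suc k) z (toℕ j))
                                else true) (allFin n)

    inB : (k : ℕ) → Pt (suc k) → Bool
    inB k z = any (λ A → inLevel k A ∧ contains k A z) 𝒜

    -- α_{k+1}(x) for x ∈ Q_k
    α : (k : ℕ) → Pt k → ℚ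
    α k x = sumFin (s k) (λ y → if inB k (x , y) then 1ℚ else 0ℚ) ÷' ℕ→ℚ (s k)

    ℙ : (k : ℕ) → Pt k → ℚ
    ℙ zero    tt      = 1ℚ
    ℙ (suc k) (x , y) =
      (if inB k (x , y)
         then 0ℚ ⊔ ((α k x - δ) ÷' (α k x * (1ℚ - δ)))
         else (1ℚ ÷' (1ℚ - α k x)) ⊓ (1ℚ ÷' (1ℚ - δ)))
      * (ℙ k x ÷' ℕ→ℚ (s k))

    𝔼α² : (k : ℕ) → ℚ
    𝔼α² k = sumPt k (λ x → α k x * α k x * ℙ k x)

    ν : (k : ℕ) → Subset k → ℚ
    ν k J = prodFin k (λ i → if lookup J i
                               then 1ℚ ÷' ((1ℚ - δ) * ℕ→ℚ (s (toℕ i)))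
                               else 1ℚ)

    -- right-hand side (for paper's index k+1):
    -- 1/|S_{k+1}|² Σ_{F₁,F₂ ⊆ {1..k}} ν(F₁ ∪ F₂)
    rhs : (k : ℕ) → ℚ
    rhs k = (1ℚ ÷' (ℕ→ℚ (s k) * ℕ→ℚ (s k)))
            * sumSubsets k (λ F₁ → sumSubsets k (λ F₂ → ν k (F₁ ∪ F₂)))

{-# OPTIONS --safe #-}
-- Let σ = |S_k|. A hyperplane of 𝒜_k fixes coordinate k, so it meets every fibre {x} × S_k in at
-- most one point. Hence σ α_k(x) is at most the number M(x) of A ∈ 𝒜_k whose projection to Q_{k-1}
-- contains x, and 𝔼_{k-1}[α_k²] ≤ σ⁻² Σ_{A,B ∈ 𝒜_k} ℙ_{k-1}(A ∩ B).
-- The weights defining ℙ_t average to at most 1 over each fibre, so passing from ℙ_{t-1} to ℙ_t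
-- never increases the mass of a fibre, while no single point gets more than ℙ_{t-1}(x) / ((1-δ)|S_t|).
-- By induction on t, ℙ_{k-1}(A ∩ B) ≤ ν((F(A) ∪ F(B)) ∩ {1, …, k-1}). Finally, non-parallel
-- hyperplanes of 𝒜_k have different fixed coordinates below k, so the double sum over 𝒜_k is
-- dominated by the sum over all pairs F₁, F₂ ⊆ {1, …, k-1}.
module Submission where

open import Defs
open import Data.Nat using (ℕ; _≤_; _<_)
open import Data.Fin using (Fin; toℕ)
open import Data.List using (List)
open import Data.List.Relation.Unary.AllPairs using (AllPairs)
open import Data.Rational using (ℚ; 0ℚ; ½)
import Data.Rational as ℚ
open import Relation.Nullary using (¬_)

open import Data.Bool using (Bool; true; false; if_then_else_; T; _∧_; _∨_)
import Data.Bool as Bool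
open import Data.Bool.ListAction using (all; any)
open import Data.Bool.Properties using (T-≡; T-not-≡; T-∧)
open import Data.Empty using (⊥-elim)
open import Data.Fin using (fromℕ<)
import Data.Fin as Fin
import Data.Fin.Properties as Finₚ
open import Data.Fin.Subset using (Subset; _∪_)
import Data.Integer as ℤ
import Data.Integer.Properties as ℤₚ
open import Data.List using ([]; _∷_; allFin; filterᵇ)
open import Data.List.Relation.Unary.All using (All; []; _∷_)
import Data.List.Relation.Unary.All as All
open import Data.List.Relation.Unary.All.Properties using (all⁺; all⁻; tabulate⁺; tabulate⁻; all-filter)
open import Data.List.Relation.Unary.AllPairs using ([]; _∷_)
import Data.List.Relation.Unary.AllPairs.Properties as AllPairs
open import Data.Maybe using (Maybe; just; is-just)
open import Data.Nat using (zero; suc; _<ᵇ_)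
import Data.Nat as ℕ
import Data.Nat.Coprimality as Coprime
import Data.Nat.Properties as ℕₚ
open import Data.Product using (_×_; _,_; proj₁; proj₂; ∃-syntax)
open import Data.Rational using (1ℚ; _+_; _*_; _-_; -_; 1/_; _⊔_; _⊓_; mkℚ)
open import Data.Rational.Properties as ℚₚ using (module ≤-Reasoning)
open import Data.Rational.Solver using (module +-*-Solver)
open import Data.Sum using (_⊎_; inj₁; inj₂)
open import Data.Vec using ([]; _∷_; tabulate; lookup)
import Data.Vec.Properties as Vecₚ
open import Function using (_∘_; Equivalence)
open import Relation.Binary.Definitions using (DecidableEquality; tri<; tri≈; tri>)
open import Relation.Binary.PropositionalEquality as ≡
  using (_≡_; _≢_; refl; sym; trans; subst; cong₂; module ≡-Reasoning)
open import Relation.Nullary using (Dec; yes; no; does)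
open import Relation.Nullary.Decidable using (T?; dec-false; toWitness)

open +-*-Solver using (solve; _:=_; _:+_; _:*_; _:-_; con)

-- Order and arithmetic on ℚ

0≤1 : 0ℚ ℚ.≤ 1ℚ
0≤1 = ℚₚ.nonNegative⁻¹ 1ℚ

nonNeg-split : ∀ {q} → 0ℚ ℚ.≤ q → q ≡ 0ℚ ⊎ 0ℚ ℚ.< q
nonNeg-split {q} 0≤q with ℚₚ.<-cmp 0ℚ q
... | tri< 0<q _ _ = inj₂ 0<q
... | tri≈ _ 0≡q _ = inj₁ (sym 0≡q)
... | tri> _ _ q<0 = ⊥-elim (ℚₚ.<-irrefl refl (ℚₚ.<-≤-trans q<0 0≤q))

zero-or-nonZero : ∀ q → q ≡ 0ℚ ⊎ q ≢ 0ℚ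
zero-or-nonZero q with q ℚₚ.≟ 0ℚ
... | yes q≡0 = inj₁ q≡0
... | no  q≢0 = inj₂ q≢0

*-nonNeg : ∀ {p q} → 0ℚ ℚ.≤ p → 0ℚ ℚ.≤ q → 0ℚ ℚ.≤ p * q
*-nonNeg {p} {q} 0≤p 0≤q = subst (ℚ._≤ p * q) (ℚₚ.*-zeroʳ p) (ℚₚ.*-monoˡ-≤-nonNeg p {{ℚ.nonNegative 0≤p}} 0≤q)

*-pos : ∀ {p q} → 0ℚ ℚ.< p → 0ℚ ℚ.< q → 0ℚ ℚ.< p * q
*-pos {p} {q} 0<p 0<q = subst (ℚ._< p * q) (ℚₚ.*-zeroʳ p) (ℚₚ.*-monoʳ-<-pos p {{ℚ.positive 0<p}} 0<q)

*-monoˡ-≤ : ∀ {r p q} → 0ℚ ℚ.≤ r → p ℚ.≤ q → r * p ℚ.≤ r * q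
*-monoˡ-≤ {r} 0≤r = ℚₚ.*-monoˡ-≤-nonNeg r {{ℚ.nonNegative 0≤r}}

*-monoʳ-≤ : ∀ {r p q} → 0ℚ ℚ.≤ r → p ℚ.≤ q → p * r ℚ.≤ q * r
*-monoʳ-≤ {r} 0≤r = ℚₚ.*-monoʳ-≤-nonNeg r {{ℚ.nonNegative 0≤r}}

*-self-mono-≤ : ∀ {p q} → 0ℚ ℚ.≤ p → p ℚ.≤ q → p * p ℚ.≤ q * q
*-self-mono-≤ 0≤p p≤q = ℚₚ.≤-trans (*-monoˡ-≤ 0≤p p≤q) (*-monoʳ-≤ (ℚₚ.≤-trans 0≤p p≤q) p≤q)

p≤q⇒0≤q-p : ∀ {p q} → p ℚ.≤ q → 0ℚ ℚ.≤ q - p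
p≤q⇒0≤q-p {p} {q} p≤q = subst (ℚ._≤ q - p) (ℚₚ.+-inverseʳ p) (ℚₚ.+-monoˡ-≤ (- p) p≤q)

p<q⇒0<q-p : ∀ {p q} → p ℚ.< q → 0ℚ ℚ.< q - p
p<q⇒0<q-p {p} {q} p<q = subst (ℚ._< q - p) (ℚₚ.+-inverseʳ p) (ℚₚ.+-monoˡ-< (- p) p<q)

p≤q⇒p-q≤0 : ∀ {p q} → p ℚ.≤ q → p - q ℚ.≤ 0ℚ
p≤q⇒p-q≤0 {p} {q} p≤q = subst (p - q ℚ.≤_) (ℚₚ.+-inverseʳ q) (ℚₚ.+-monoˡ-≤ (- q) p≤q)

0≤q⇒p-q≤p : ∀ {p q} → 0ℚ ℚ.≤ q → p - q ℚ.≤ p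
0≤q⇒p-q≤p {p} {q} 0≤q = subst (p - q ℚ.≤_) (ℚₚ.+-identityʳ p) (ℚₚ.+-monoʳ-≤ p (ℚₚ.neg-antimono-≤ 0≤q))

ℕ→ℚ-nonNeg : ∀ m → 0ℚ ℚ.≤ ℕ→ℚ m
ℕ→ℚ-nonNeg m = ℚₚ.nonNegative⁻¹ _ {{ℚₚ.normalize-nonNeg m 1}}

ℕ→ℚ-suc-pos : ∀ m → 0ℚ ℚ.< ℕ→ℚ (suc m)
ℕ→ℚ-suc-pos m = ℚₚ.positive⁻¹ _ {{ℚₚ.normalize-pos (suc m) 1}}

ℕ→ℚ-suc : ∀ m → ℕ→ℚ (suc m) ≡ 1ℚ + ℕ→ℚ m
ℕ→ℚ-suc m = begin
  (ℤ.+ suc m) ℚ./ 1     ≡⟨ ≡.cong (λ i → (ℤ.+ 1 ℤ.+ i) ℚ./ 1) (sym (ℤₚ.*-identityʳ (ℤ.+ m))) ⟩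
  1ℚ + mkℚ (ℤ.+ m) 0 c  ≡⟨ ≡.cong (1ℚ +_) (sym (ℚₚ.normalize-coprime c)) ⟩
  1ℚ + ℕ→ℚ m            ∎
  where
  open ≡-Reasoning
  c = Coprime.sym (Coprime.1-coprimeTo m)

÷'-by-nonZero : ∀ p {q} (q≢0 : q ≢ 0ℚ) → p ÷' q ≡ (p ℚ.÷ q) {{ℚ.≢-nonZero q≢0}}
÷'-by-nonZero p {q} q≢0 with q ℚₚ.≟ 0ℚ
... | yes q≡0 = ⊥-elim (q≢0 q≡0)
... | no  _   = refl

*-÷'-cancel : ∀ p {q} → q ≢ 0ℚ → q * (p ÷' q) ≡ p
*-÷'-cancel p {q} q≢0 = begin
  q * (p ÷' q)    ≡⟨ ≡.cong (q *_) (÷'-by-nonZero p q≢0) ⟩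
  q * (p * 1/ q)  ≡⟨ solve 3 (λ q p r → q :* (p :* r) := p :* (q :* r)) refl q p (1/ q) ⟩
  p * (q * 1/ q)  ≡⟨ ≡.cong (p *_) (ℚₚ.*-inverseʳ q) ⟩
  p * 1ℚ          ≡⟨ ℚₚ.*-identityʳ p ⟩
  p               ∎
  where
  open ≡-Reasoning
  instance _ = ℚ.≢-nonZero q≢0

÷'-unique : ∀ {p q z} → q ≢ 0ℚ → q * z ≡ p → p ÷' q ≡ z
÷'-unique {q = q} {z} q≢0 refl = begin
  (q * z) ÷' q    ≡⟨ ÷'-by-nonZero (q * z) q≢0 ⟩
  q * z * 1/ q    ≡⟨ solve 3 (λ q z r → q :* z :* r := z :* (q :* r)) refl q z (1/ q) ⟩
  z * (q * 1/ q)  ≡⟨ ≡.cong (z *_) (ℚₚ.*-inverseʳ q) ⟩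
  z * 1ℚ          ≡⟨ ℚₚ.*-identityʳ z ⟩
  z               ∎
  where
  open ≡-Reasoning
  instance _ = ℚ.≢-nonZero q≢0

*-cancelˡ-≢0 : ∀ {r p q} → r ≢ 0ℚ → r * p ≡ r * q → p ≡ q
*-cancelˡ-≢0 {r} r≢0 rp≡rq =
  trans (sym (÷'-unique r≢0 refl)) (trans (≡.cong (_÷' r) rp≡rq) (÷'-unique r≢0 refl))

-- Because p ÷' 0 = 0, the lemmas below need no hypothesis q ≢ 0.

÷'≡*1÷' : ∀ p q → p ÷' q ≡ p * (1ℚ ÷' q)
÷'≡*1÷' p q with zero-or-nonZero q
... | inj₁ refl = sym (ℚₚ.*-zeroʳ p)
... | inj₂ q≢0  = ÷'-unique q≢0 (begin
  q * (p * (1ℚ ÷' q))  ≡⟨ solve 3 (λ q p r → q :* (p :* r) := p :* (q :* r)) refl q p (1ℚ ÷' q) ⟩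
  p * (q * (1ℚ ÷' q))  ≡⟨ ≡.cong (p *_) (*-÷'-cancel 1ℚ q≢0) ⟩
  p * 1ℚ               ≡⟨ ℚₚ.*-identityʳ p ⟩
  p                    ∎)
  where open ≡-Reasoning

*-≢0 : ∀ {p q} → p ≢ 0ℚ → q ≢ 0ℚ → p * q ≢ 0ℚ
*-≢0 {p} {q} p≢0 q≢0 pq≡0 = p≢0 (begin
  p                    ≡⟨ sym (*-÷'-cancel p q≢0) ⟩
  q * (p ÷' q)         ≡⟨ ≡.cong (q *_) (÷'≡*1÷' p q) ⟩
  q * (p * (1ℚ ÷' q))  ≡⟨ solve 3 (λ q p r → q :* (p :* r) := p :* q :* r) refl q p (1ℚ ÷' q) ⟩
  p * q * (1ℚ ÷' q)    ≡⟨ ≡.cong (_* (1ℚ ÷' q)) pq≡0 ⟩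
  0ℚ * (1ℚ ÷' q)       ≡⟨ ℚₚ.*-zeroˡ (1ℚ ÷' q) ⟩
  0ℚ                   ∎)
  where open ≡-Reasoning

1÷'-* : ∀ p q → 1ℚ ÷' (p * q) ≡ (1ℚ ÷' p) * (1ℚ ÷' q)
1÷'-* p q with zero-or-nonZero p | zero-or-nonZero q
... | inj₁ refl | _         = trans (≡.cong (1ℚ ÷'_) (ℚₚ.*-zeroˡ q)) (sym (ℚₚ.*-zeroˡ (1ℚ ÷' q)))
... | inj₂ _    | inj₁ refl = trans (≡.cong (1ℚ ÷'_) (ℚₚ.*-zeroʳ p)) (sym (ℚₚ.*-zeroʳ (1ℚ ÷' p)))
... | inj₂ p≢0  | inj₂ q≢0  = ÷'-unique (*-≢0 p≢0 q≢0) (begin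
  p * q * ((1ℚ ÷' p) * (1ℚ ÷' q))
    ≡⟨ solve 4 (λ p q a b → p :* q :* (a :* b) := p :* a :* (q :* b)) refl p q (1ℚ ÷' p) (1ℚ ÷' q) ⟩
  p * (1ℚ ÷' p) * (q * (1ℚ ÷' q))
    ≡⟨ cong₂ _*_ (*-÷'-cancel 1ℚ p≢0) (*-÷'-cancel 1ℚ q≢0) ⟩
  1ℚ * 1ℚ
    ≡⟨ ℚₚ.*-identityˡ 1ℚ ⟩
  1ℚ ∎)
  where open ≡-Reasoning

÷'-≤ : ∀ {p q z} → 0ℚ ℚ.≤ q → 0ℚ ℚ.≤ z → p ℚ.≤ q * z → p ÷' q ℚ.≤ z
÷'-≤ {p} {q} {z} 0≤q 0≤z p≤qz with nonNeg-split 0≤q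
... | inj₁ refl = 0≤z
... | inj₂ 0<q  = ℚₚ.*-cancelˡ-≤-pos q {{ℚ.positive 0<q}}
                    (subst (ℚ._≤ q * z) (sym (*-÷'-cancel p (ℚₚ.<⇒≢ 0<q ∘ sym))) p≤qz)

≤-÷' : ∀ {p q z} → 0ℚ ℚ.< q → q * z ℚ.≤ p → z ℚ.≤ p ÷' q
≤-÷' {p} {q} {z} 0<q qz≤p = ℚₚ.*-cancelˡ-≤-pos q {{ℚ.positive 0<q}}
  (subst (q * z ℚ.≤_) (sym (*-÷'-cancel p (ℚₚ.<⇒≢ 0<q ∘ sym))) qz≤p)

÷'-nonNeg : ∀ {p q} → 0ℚ ℚ.≤ p → 0ℚ ℚ.≤ q → 0ℚ ℚ.≤ p ÷' q
÷'-nonNeg {p} {q} 0≤p 0≤q with nonNeg-split 0≤q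
... | inj₁ refl = ℚₚ.≤-refl
... | inj₂ 0<q  = ≤-÷' 0<q (subst (ℚ._≤ p) (sym (ℚₚ.*-zeroʳ q)) 0≤p)

*-÷'-≤ : ∀ {p q} → 0ℚ ℚ.≤ p → 0ℚ ℚ.≤ q → q * (p ÷' q) ℚ.≤ p
*-÷'-≤ {p} {q} 0≤p 0≤q with nonNeg-split 0≤q
... | inj₁ refl = subst (ℚ._≤ p) (sym (ℚₚ.*-zeroˡ (p ÷' 0ℚ))) 0≤p
... | inj₂ 0<q  = ℚₚ.≤-reflexive (*-÷'-cancel p (ℚₚ.<⇒≢ 0<q ∘ sym))

𝟙 : Bool → ℚ
𝟙 b = if b then 1ℚ else 0ℚ

𝟙-nonNeg : ∀ b → 0ℚ ℚ.≤ 𝟙 b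
𝟙-nonNeg true  = 0≤1
𝟙-nonNeg false = ℚₚ.≤-refl

𝟙-≤-1 : ∀ b → 𝟙 b ℚ.≤ 1ℚ
𝟙-≤-1 true  = ℚₚ.≤-refl
𝟙-≤-1 false = 0≤1

𝟙-mono : ∀ {a b} → (T a → T b) → 𝟙 a ℚ.≤ 𝟙 b
𝟙-mono {true}  {true}  _   = ℚₚ.≤-refl
𝟙-mono {true}  {false} a⇒b = ⊥-elim (a⇒b _)
𝟙-mono {false} {b}     _   = 𝟙-nonNeg b

𝟙-∧ : ∀ a b → 𝟙 (a ∧ b) ≡ 𝟙 a * 𝟙 b
𝟙-∧ true  b = sym (ℚₚ.*-identityˡ (𝟙 b))
𝟙-∧ false b = sym (ℚₚ.*-zeroˡ (𝟙 b))

𝟙-∨ : ∀ a b → 𝟙 (a ∨ b) ℚ.≤ 𝟙 a + 𝟙 b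
𝟙-∨ true  b = ℚₚ.≤-trans (ℚₚ.≤-reflexive (sym (ℚₚ.+-identityʳ 1ℚ))) (ℚₚ.+-monoʳ-≤ 1ℚ (𝟙-nonNeg b))
𝟙-∨ false b = ℚₚ.≤-reflexive (sym (ℚₚ.+-identityˡ (𝟙 b)))

if-as-𝟙 : ∀ b u v → (if b then u else v) ≡ v + (u - v) * 𝟙 b
if-as-𝟙 true  u v = solve 2 (λ u v → u := v :+ (u :- v) :* con 1ℚ) refl u v
if-as-𝟙 false u v = solve 2 (λ u v → v := v :+ (u :- v) :* con 0ℚ) refl u v

-- Finite sums as linear functionals

sumList : {X : Set} → List X → (X → ℚ) → ℚ
sumList []       f = 0ℚ
sumList (a ∷ as) f = f a + sumList as f

record IsSummation {X : Set} (∑ : (X → ℚ) → ℚ) : Set where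
  field
    cong   : ∀ {f g} → (∀ x → f x ≡ g x) → ∑ f ≡ ∑ g
    +-homo : ∀ f g → ∑ (λ x → f x + g x) ≡ ∑ f + ∑ g
    *-homo : ∀ a f → ∑ (λ x → a * f x) ≡ a * ∑ f
    mono   : ∀ {f g} → (∀ x → f x ℚ.≤ g x) → ∑ f ℚ.≤ ∑ g

  0-homo : ∑ (λ _ → 0ℚ) ≡ 0ℚ
  0-homo = begin
    ∑ (λ _ → 0ℚ)       ≡⟨ cong (λ _ → sym (ℚₚ.*-zeroˡ 0ℚ)) ⟩
    ∑ (λ _ → 0ℚ * 0ℚ)  ≡⟨ *-homo 0ℚ (λ _ → 0ℚ) ⟩
    0ℚ * ∑ (λ _ → 0ℚ)  ≡⟨ ℚₚ.*-zeroˡ (∑ (λ _ → 0ℚ)) ⟩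
    0ℚ                 ∎
    where open ≡-Reasoning

  nonNeg : ∀ {f} → (∀ x → 0ℚ ℚ.≤ f x) → 0ℚ ℚ.≤ ∑ f
  nonNeg {f} 0≤f = subst (ℚ._≤ ∑ f) 0-homo (mono 0≤f)

  *ʳ-homo : ∀ a f → ∑ (λ x → f x * a) ≡ ∑ f * a
  *ʳ-homo a f = trans (cong (λ x → ℚₚ.*-comm (f x) a)) (trans (*-homo a f) (ℚₚ.*-comm a (∑ f)))

  product-of-sums : ∀ f g → ∑ f * ∑ g ≡ ∑ (λ x → ∑ (λ y → f x * g y))
  product-of-sums f g = sym (trans (cong (λ x → *-homo (f x) g)) (*ʳ-homo (∑ g) f))

  swap-sumList : ∀ {Y : Set} (L : List Y) (f : X → Y → ℚ) →
                 ∑ (λ x → sumList L (f x)) ≡ sumList L (λ a → ∑ (λ x → f x a))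
  swap-sumList []      f = 0-homo
  swap-sumList (a ∷ L) f = trans (+-homo (λ x → f x a) (λ x → sumList L (f x)))
                                 (≡.cong (∑ (λ x → f x a) +_) (swap-sumList L f))

module _ {X : Set} where

  eval-isSummation : (a : X) → IsSummation (λ f → f a)
  eval-isSummation a = record
    { cong   = λ f≗g → f≗g a
    ; +-homo = λ _ _ → refl
    ; *-homo = λ _ _ → refl
    ; mono   = λ f≤g → f≤g a
    }

  zero-isSummation : IsSummation {X} (λ _ → 0ℚ)
  zero-isSummation = record
    { cong   = λ _ → refl
    ; +-homo = λ _ _ → sym (ℚₚ.+-identityʳ 0ℚ)
    ; *-homo = λ a _ → sym (ℚₚ.*-zeroʳ a)
    ; mono   = λ _ → ℚₚ.≤-refl
    }

  +-isSummation : ∀ {∑₁ ∑₂ : (X → ℚ) → ℚ} → IsSummation ∑₁ → IsSummation ∑₂ →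
                  IsSummation (λ f → ∑₁ f + ∑₂ f)
  +-isSummation {∑₁} {∑₂} S₁ S₂ = record
    { cong   = λ f≗g → cong₂ _+_ (S₁.cong f≗g) (S₂.cong f≗g)
    ; +-homo = λ f g → trans (cong₂ _+_ (S₁.+-homo f g) (S₂.+-homo f g))
                             (+-interchange (∑₁ f) (∑₁ g) (∑₂ f) (∑₂ g))
    ; *-homo = λ a f → trans (cong₂ _+_ (S₁.*-homo a f) (S₂.*-homo a f))
                             (sym (ℚₚ.*-distribˡ-+ a (∑₁ f) (∑₂ f)))
    ; mono   = λ f≤g → ℚₚ.+-mono-≤ (S₁.mono f≤g) (S₂.mono f≤g)
    }
    where
    module S₁ = IsSummation S₁
    module S₂ = IsSummation S₂
    +-interchange : ∀ a b c d → a + b + (c + d) ≡ a + c + (b + d)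
    +-interchange = solve 4 (λ a b c d → a :+ b :+ (c :+ d) := a :+ c :+ (b :+ d)) refl

  ∘-isSummation : ∀ {Y : Set} {∑ : (Y → ℚ) → ℚ} (g : Y → X) → IsSummation ∑ →
                  IsSummation (λ (f : X → ℚ) → ∑ (λ y → f (g y)))
  ∘-isSummation g S = record
    { cong   = λ f≗h → S.cong (λ y → f≗h (g y))
    ; +-homo = λ f h → S.+-homo (λ y → f (g y)) (λ y → h (g y))
    ; *-homo = λ a f → S.*-homo a (λ y → f (g y))
    ; mono   = λ f≤h → S.mono (λ y → f≤h (g y))
    }
    where module S = IsSummation S

  iterated-isSummation : ∀ {Y : Set} {∑₁ : (X → ℚ) → ℚ} {∑₂ : (Y → ℚ) → ℚ} →
                         IsSummation ∑₁ → IsSummation ∑₂ →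
                         IsSummation (λ (f : X × Y → ℚ) → ∑₁ (λ x → ∑₂ (λ y → f (x , y))))
  iterated-isSummation {∑₂ = ∑₂} S₁ S₂ = record
    { cong   = λ f≗g → S₁.cong (λ x → S₂.cong (λ y → f≗g (x , y)))
    ; +-homo = λ f g → trans (S₁.cong (λ x → S₂.+-homo (λ y → f (x , y)) (λ y → g (x , y))))
                             (S₁.+-homo (λ x → ∑₂ (λ y → f (x , y))) (λ x → ∑₂ (λ y → g (x , y))))
    ; *-homo = λ a f → trans (S₁.cong (λ x → S₂.*-homo a (λ y → f (x , y))))
                             (S₁.*-homo a (λ x → ∑₂ (λ y → f (x , y))))
    ; mono   = λ f≤g → S₁.mono (λ x → S₂.mono (λ y → f≤g (x , y)))
    }
    where
    module S₁ = IsSummation S₁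
    module S₂ = IsSummation S₂

sumList-isSummation : ∀ {X : Set} (L : List X) → IsSummation (sumList L)
sumList-isSummation []      = zero-isSummation
sumList-isSummation (a ∷ L) = +-isSummation (eval-isSummation a) (sumList-isSummation L)

sumFin-isSummation : ∀ m → IsSummation (sumFin m)
sumFin-isSummation zero    = zero-isSummation
sumFin-isSummation (suc m) =
  +-isSummation (eval-isSummation Fin.zero) (∘-isSummation Fin.suc (sumFin-isSummation m))

sumSubsets-isSummation : ∀ k → IsSummation (sumSubsets k)
sumSubsets-isSummation zero    = eval-isSummation []
sumSubsets-isSummation (suc k) = +-isSummation (∘-isSummation (false ∷_) (sumSubsets-isSummation k))
                                               (∘-isSummation (true ∷_) (sumSubsets-isSummation k))

sumPt-isSummation : ∀ s k → IsSummation (sumPt s k)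
sumPt-isSummation s zero    = eval-isSummation _
sumPt-isSummation s (suc k) = iterated-isSummation (sumPt-isSummation s k) (sumFin-isSummation (s k))

module SumList {X : Set} (L : List X) = IsSummation (sumList-isSummation L)
module SumFin (m : ℕ) = IsSummation (sumFin-isSummation m)
module SumSubsets (k : ℕ) = IsSummation (sumSubsets-isSummation k)
module SumPt (s : ℕ → ℕ) (k : ℕ) = IsSummation (sumPt-isSummation s k)

sumList-mono-All : ∀ {X : Set} {L : List X} {f g : X → ℚ} →
                   All (λ a → f a ℚ.≤ g a) L → sumList L f ℚ.≤ sumList L g
sumList-mono-All []           = ℚₚ.≤-refl
sumList-mono-All (fa≤ga ∷ fs) = ℚₚ.+-mono-≤ fa≤ga (sumList-mono-All fs)

sumList-cong-All : ∀ {X : Set} {L : List X} {f g : X → ℚ} →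
                   All (λ a → f a ≡ g a) L → sumList L f ≡ sumList L g
sumList-cong-All []           = refl
sumList-cong-All (fa≡ga ∷ fs) = cong₂ _+_ fa≡ga (sumList-cong-All fs)

sumList-filterᵇ : ∀ {X : Set} (q : X → Bool) (L : List X) (f : X → ℚ) →
                  sumList (filterᵇ q L) f ≡ sumList L (λ a → 𝟙 (q a) * f a)
sumList-filterᵇ q []      f = refl
sumList-filterᵇ q (a ∷ L) f with q a
... | true  = cong₂ _+_ (sym (ℚₚ.*-identityˡ (f a))) (sumList-filterᵇ q L f)
... | false = trans (sumList-filterᵇ q L f)
                    (trans (sym (ℚₚ.+-identityˡ _)) (≡.cong (_+ _) (sym (ℚₚ.*-zeroˡ (f a)))))

𝟙-any-≤ : ∀ {X : Set} (p : X → Bool) (L : List X) → 𝟙 (any p L) ℚ.≤ sumList L (λ a → 𝟙 (p a))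
𝟙-any-≤ p []      = ℚₚ.≤-refl
𝟙-any-≤ p (a ∷ L) = ℚₚ.≤-trans (𝟙-∨ (p a) (any p L)) (ℚₚ.+-monoʳ-≤ (𝟙 (p a)) (𝟙-any-≤ p L))

sumFin-const : ∀ m a → sumFin m (λ _ → a) ≡ ℕ→ℚ m * a
sumFin-const zero    a = sym (ℚₚ.*-zeroˡ a)
sumFin-const (suc m) a = begin
  a + sumFin m (λ _ → a)  ≡⟨ ≡.cong (a +_) (sumFin-const m a) ⟩
  a + ℕ→ℚ m * a           ≡⟨ solve 2 (λ a b → a :+ b :* a := (con 1ℚ :+ b) :* a) refl a (ℕ→ℚ m) ⟩
  (1ℚ + ℕ→ℚ m) * a        ≡⟨ ≡.cong (_* a) (sym (ℕ→ℚ-suc m)) ⟩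
  ℕ→ℚ (suc m) * a         ∎
  where open ≡-Reasoning

average : ∀ m → (Fin m → ℚ) → ℚ
average m f = sumFin m f ÷' ℕ→ℚ m

ℕ→ℚ-*-average : ∀ m (f : Fin m → ℚ) → ℕ→ℚ m * average m f ≡ sumFin m f
ℕ→ℚ-*-average zero    f = ℚₚ.*-zeroˡ (average zero f)
ℕ→ℚ-*-average (suc m) f = *-÷'-cancel (sumFin (suc m) f) (ℚₚ.<⇒≢ (ℕ→ℚ-suc-pos m) ∘ sym)

average-𝟙-nonNeg : ∀ m (P : Fin m → Bool) → 0ℚ ℚ.≤ average m (λ y → 𝟙 (P y))
average-𝟙-nonNeg m P = ÷'-nonNeg (SumFin.nonNeg m (λ y → 𝟙-nonNeg (P y))) (ℕ→ℚ-nonNeg m)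

average-𝟙-≤-1 : ∀ m (P : Fin m → Bool) → average m (λ y → 𝟙 (P y)) ℚ.≤ 1ℚ
average-𝟙-≤-1 m P = ÷'-≤ (ℕ→ℚ-nonNeg m) 0≤1 (begin
  sumFin m (λ y → 𝟙 (P y))  ≤⟨ SumFin.mono m (λ y → 𝟙-≤-1 (P y)) ⟩
  sumFin m (λ _ → 1ℚ)       ≡⟨ sumFin-const m 1ℚ ⟩
  ℕ→ℚ m * 1ℚ                ∎)
  where open ≤-Reasoning

AtMostOne : ∀ {m} → (Fin m → Bool) → Set
AtMostOne P = ∀ {y y′} → T (P y) → T (P y′) → y ≡ y′

atMostOne-⊆ : ∀ {m} {P Q : Fin m → Bool} → (∀ y → T (Q y) → T (P y)) → AtMostOne P → AtMostOne Q
atMostOne-⊆ Q⇒P atMostOne {y} {y′} Qy Qy′ = atMostOne (Q⇒P y Qy) (Q⇒P y′ Qy′)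

sumFin-𝟙-≤-1 : ∀ m {P : Fin m → Bool} → AtMostOne P → sumFin m (λ y → 𝟙 (P y)) ℚ.≤ 1ℚ
sumFin-𝟙-≤-1 zero    _ = 0≤1
sumFin-𝟙-≤-1 (suc m) {P} atMostOne with P Fin.zero in P0
... | true  = ℚₚ.≤-trans (ℚₚ.+-monoʳ-≤ 1ℚ rest≤0) (ℚₚ.≤-reflexive (ℚₚ.+-identityʳ 1ℚ))
  where
  rest≤0 : sumFin m (λ i → 𝟙 (P (Fin.suc i))) ℚ.≤ 0ℚ
  rest≤0 = ℚₚ.≤-trans (SumFin.mono m (λ i → 𝟙-mono (Finₚ.0≢1+n ∘ atMostOne (subst T (sym P0) _))))
                      (ℚₚ.≤-reflexive (SumFin.0-homo m))
... | false = ℚₚ.≤-trans (ℚₚ.≤-reflexive (ℚₚ.+-identityˡ _))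
                         (sumFin-𝟙-≤-1 m (λ Py Py′ → Finₚ.suc-injective (atMostOne Py Py′)))

sumFin-𝟙-≤ : ∀ m {P : Fin m → Bool} {b} → AtMostOne P → (∀ y → T (P y) → T b) →
             sumFin m (λ y → 𝟙 (P y)) ℚ.≤ 𝟙 b
sumFin-𝟙-≤ m {b = true}  atMostOne _   = sumFin-𝟙-≤-1 m atMostOne
sumFin-𝟙-≤ m {b = false} _         P⇒b =
  ℚₚ.≤-trans (SumFin.mono m (λ y → 𝟙-mono (P⇒b y))) (ℚₚ.≤-reflexive (SumFin.0-homo m))

prodFin-cong : ∀ m {f g : Fin m → ℚ} → (∀ i → f i ≡ g i) → prodFin m f ≡ prodFin m g
prodFin-cong zero    f≗g = refl
prodFin-cong (suc m) f≗g = cong₂ _*_ (f≗g Fin.zero) (prodFin-cong m (λ i → f≗g (Fin.suc i)))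

prodFin-nonNeg : ∀ m {f : Fin m → ℚ} → (∀ i → 0ℚ ℚ.≤ f i) → 0ℚ ℚ.≤ prodFin m f
prodFin-nonNeg zero    _   = 0≤1
prodFin-nonNeg (suc m) 0≤f = *-nonNeg (0≤f Fin.zero) (prodFin-nonNeg m (λ i → 0≤f (Fin.suc i)))

prodFin-toℕ-suc : ∀ k (g : ℕ → ℚ) → prodFin (suc k) (λ i → g (toℕ i)) ≡ prodFin k (λ i → g (toℕ i)) * g k
prodFin-toℕ-suc zero    g = ℚₚ.*-comm (g 0) 1ℚ
prodFin-toℕ-suc (suc k) g = trans (≡.cong (g 0 *_) (prodFin-toℕ-suc k (λ t → g (suc t))))
                                  (sym (ℚₚ.*-assoc (g 0) _ (g (suc k))))

_≟ₛ_ : ∀ {k} → DecidableEquality (Subset k)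
_≟ₛ_ = Vecₚ.≡-dec Bool._≟_

sumSubsets-point : ∀ k (h : Subset k → ℚ) u →
                   sumSubsets k (λ J → if does (J ≟ₛ u) then h J else 0ℚ) ≡ h u
sumSubsets-point zero    h []          = refl
sumSubsets-point (suc k) h (false ∷ u) =
  trans (cong₂ _+_ (sumSubsets-point k (λ J → h (false ∷ J)) u) (SumSubsets.0-homo k)) (ℚₚ.+-identityʳ _)
sumSubsets-point (suc k) h (true ∷ u)  =
  trans (cong₂ _+_ (SumSubsets.0-homo k) (sumSubsets-point k (λ J → h (true ∷ J)) u)) (ℚₚ.+-identityˡ _)

sumSubsets-remove : ∀ k (h : Subset k → ℚ) u →
                    sumSubsets k h ≡ h u + sumSubsets k (λ J → if does (J ≟ₛ u) then 0ℚ else h J)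
sumSubsets-remove k h u = begin
  sumSubsets k h                        ≡⟨ SumSubsets.cong k (λ J → split (does (J ≟ₛ u)) (h J)) ⟩
  sumSubsets k (λ J → atU J + offU J)   ≡⟨ SumSubsets.+-homo k atU offU ⟩
  sumSubsets k atU + sumSubsets k offU  ≡⟨ ≡.cong (_+ sumSubsets k offU) (sumSubsets-point k h u) ⟩
  h u + sumSubsets k offU               ∎
  where
  open ≡-Reasoning
  atU offU : Subset k → ℚ
  atU  J = if does (J ≟ₛ u) then h J else 0ℚ
  offU J = if does (J ≟ₛ u) then 0ℚ else h J
  split : ∀ b x → x ≡ (if b then x else 0ℚ) + (if b then 0ℚ else x)
  split true  x = sym (ℚₚ.+-identityʳ x)
  split false x = sym (ℚₚ.+-identityˡ x)

sumList-≤-sumSubsets : ∀ {X : Set} k (F : X → Subset k) {L : List X} →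
                       AllPairs (λ a b → F a ≢ F b) L →
                       (h : Subset k → ℚ) → (∀ J → 0ℚ ℚ.≤ h J) →
                       sumList L (λ a → h (F a)) ℚ.≤ sumSubsets k h
sumList-≤-sumSubsets k F []                         h 0≤h = SumSubsets.nonNeg k 0≤h
sumList-≤-sumSubsets k F {a ∷ L} (Fa≢ ∷ distinct) h 0≤h = begin
  h (F a) + sumList L (λ b → h (F b))   ≡⟨ ≡.cong (h (F a) +_) (sumList-cong-All (All.map unchanged Fa≢)) ⟩
  h (F a) + sumList L (λ b → h′ (F b))  ≤⟨ ℚₚ.+-monoʳ-≤ (h (F a)) (sumList-≤-sumSubsets k F distinct h′ 0≤h′) ⟩
  h (F a) + sumSubsets k h′             ≡⟨ sym (sumSubsets-remove k h (F a)) ⟩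
  sumSubsets k h                        ∎
  where
  open ≤-Reasoning
  h′ : Subset k → ℚ
  h′ J = if does (J ≟ₛ F a) then 0ℚ else h J
  0≤h′ : ∀ J → 0ℚ ℚ.≤ h′ J
  0≤h′ J with does (J ≟ₛ F a)
  ... | true  = ℚₚ.≤-refl
  ... | false = 0≤h J
  unchanged : ∀ {b} → F a ≢ F b → h (F b) ≡ h′ (F b)
  unchanged {b} Fa≢Fb = ≡.cong (λ c → if c then 0ℚ else h (F b)) (sym (dec-false (F b ≟ₛ F a) (Fa≢Fb ∘ sym)))

sumList²-≤-sumSubsets² : ∀ {X : Set} k (F : X → Subset k) {L : List X} →
                         AllPairs (λ a b → F a ≢ F b) L →
                         (g : Subset k → Subset k → ℚ) → (∀ J₁ J₂ → 0ℚ ℚ.≤ g J₁ J₂) →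
                         sumList L (λ a → sumList L (λ b → g (F a) (F b)))
                           ℚ.≤ sumSubsets k (λ J₁ → sumSubsets k (λ J₂ → g J₁ J₂))
sumList²-≤-sumSubsets² k F {L} distinct g 0≤g =
  ℚₚ.≤-trans (SumList.mono L (λ a → sumList-≤-sumSubsets k F distinct (g (F a)) (0≤g (F a))))
             (sumList-≤-sumSubsets k F distinct (λ J₁ → sumSubsets k (g J₁)) (λ J₁ → SumSubsets.nonNeg k (0≤g J₁)))

allPairs-under-All : ∀ {X : Set} {P : X → Set} {R S : X → X → Set} {L : List X} →
                     (∀ {a b} → P a → P b → R a b → S a b) → All P L → AllPairs R L → AllPairs S L
allPairs-under-All R⇒S []        []          = []
allPairs-under-All R⇒S (pa ∷ ps) (Ra∼ ∷ rs) =
  All.zipWith (λ (pb , Rab) → R⇒S pa pb Rab) (ps , Ra∼) ∷ allPairs-under-All R⇒S ps rs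

-- Hyperplanes

if-true⁻ : ∀ {b p q} → T b → T (if b then p else q) → T p
if-true⁻ {true} _ h = h

if-false⁻ : ∀ {b p q} → ¬ T b → T (if b then p else q) → T q
if-false⁻ {true}  ¬b _ = ⊥-elim (¬b _)
if-false⁻ {false} _  h = h

if-then-true⁺ : ∀ {b p} → (T b → T p) → T (if b then p else true)
if-then-true⁺ {true}  b⇒p = b⇒p _
if-then-true⁺ {false} _   = _

T-does⇒ : ∀ {P : Set} (d : Dec P) → T (does d) → P
T-does⇒ (yes p) _ = p

all-allFin⁻ : ∀ {n} (p : Fin n → Bool) → T (all p (allFin n)) → ∀ j → T (p j)
all-allFin⁻ {n} p h = tabulate⁻ (all⁺ p (allFin n) h)

all-allFin⁺ : ∀ {n} (p : Fin n → Bool) → (∀ j → T (p j)) → T (all p (allFin n))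
all-allFin⁺ p h = all⁻ p (tabulate⁺ h)

fixedAt : ∀ {n} {P : Fin n → Set} → ((j : Fin n) → Maybe (P j)) → ℕ → Bool
fixedAt {zero}  A t       = false
fixedAt {suc n} A zero    = is-just (A Fin.zero)
fixedAt {suc n} A (suc t) = fixedAt (λ j → A (Fin.suc j)) t

fixedAt-toℕ : ∀ {n} {P : Fin n → Set} (A : (j : Fin n) → Maybe (P j)) j →
              fixedAt A (toℕ j) ≡ is-just (A j)
fixedAt-toℕ A Fin.zero    = refl
fixedAt-toℕ A (Fin.suc j) = fixedAt-toℕ (λ i → A (Fin.suc i)) j

fixedAt⁻ : ∀ {n} {P : Fin n → Set} (A : (j : Fin n) → Maybe (P j)) t →
           T (fixedAt A t) → ∃[ j ] toℕ j ≡ t × T (is-just (A j))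
fixedAt⁻ {suc n} A zero    h = Fin.zero , refl , h
fixedAt⁻ {suc n} A (suc t) h with fixedAt⁻ (λ j → A (Fin.suc j)) t h
... | j , refl , Aj = Fin.suc j , refl , Aj

module Hyperplanes (s : ℕ → ℕ) (n : ℕ) (δ : ℚ) (𝒜 : List (Hyp s n)) where

  agree′ : {m : ℕ} → Maybe (Fin m) → Maybe (Fin m) → Bool
  agree′ = agree s n δ 𝒜

  inLevel′ : ℕ → Hyp s n → Bool
  inLevel′ = inLevel s n δ 𝒜

  member : (k : ℕ) → Hyp s n → Pt s k → Bool
  member k A x = all (λ j → if toℕ j <ᵇ k then agree′ (A j) (coord s k x (toℕ j)) else true) (allFin n)

  member⁻ : ∀ k A x → T (member k A x) → ∀ j → toℕ j < k → T (agree′ (A j) (coord s k x (toℕ j)))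
  member⁻ k A x h j j<k = if-true⁻ (ℕₚ.<⇒<ᵇ j<k) (all-allFin⁻ _ h j)

  member⁺ : ∀ k A x → (∀ j → toℕ j < k → T (agree′ (A j) (coord s k x (toℕ j)))) → T (member k A x)
  member⁺ k A x h = all-allFin⁺ _ (λ j → if-then-true⁺ (h j ∘ ℕₚ.<ᵇ⇒< (toℕ j) k))

  coord-init : ∀ k (x : Pt s k) y {t} → t ≢ k → coord s (suc k) (x , y) t ≡ coord s k x t
  coord-init k x y {t} t≢k with t ℕ.≟ k
  ... | yes t≡k = ⊥-elim (t≢k t≡k)
  ... | no  _   = refl

  coord-last : ∀ k (x : Pt s k) y → coord s (suc k) (x , y) k ≡ just y
  coord-last k x y with k ℕ.≟ k
  ... | yes refl = refl
  ... | no  k≢k  = ⊥-elim (k≢k refl)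

  member-init : ∀ k A (x : Pt s k) y → T (member (suc k) A (x , y)) → T (member k A x)
  member-init k A x y h = member⁺ k A x (λ j j<k →
    subst (T ∘ agree′ (A j)) (coord-init k x y (ℕₚ.<⇒≢ j<k))
          (member⁻ (suc k) A (x , y) h j (ℕₚ.m<n⇒m<1+n j<k)))

  member-atMostOne : ∀ A (j : Fin n) {k} (x : Pt s k) → toℕ j ≡ k → T (is-just (A j)) →
                     AtMostOne (λ y → member (suc k) A (x , y))
  member-atMostOne A j x refl Aj-fixed {y} {y′} h h′ with A j in Aj≡ | Aj-fixed
  ... | just a | _ = trans (sym (pinned h)) (pinned h′)
    where
    pinned : ∀ {z} → T (member (suc (toℕ j)) A (x , z)) → a ≡ z
    pinned {z} hz = T-does⇒ (a Fin.≟ z) (subst (λ c → T (agree′ c (just z))) Aj≡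
                      (subst (T ∘ agree′ (A j)) (coord-last (toℕ j) x z)
                        (member⁻ (suc (toℕ j)) A (x , z) hz j (ℕₚ.n<1+n (toℕ j)))))

  fixedAt-atMostOne : ∀ A {k} (x : Pt s k) → T (fixedAt A k) → AtMostOne (λ y → member (suc k) A (x , y))
  fixedAt-atMostOne A {k} x h with fixedAt⁻ A k h
  ... | j , toℕj≡k , Aj-fixed = member-atMostOne A j x toℕj≡k Aj-fixed

  level-fixed : ∀ {k A} → T (inLevel′ k A) → ∀ j → toℕ j ≡ k → T (is-just (A j))
  level-fixed {k} h j toℕj≡k = if-true⁻ (ℕₚ.≡⇒≡ᵇ (toℕ j) k toℕj≡k) (all-allFin⁻ _ h j)

  level-free : ∀ {k A} → T (inLevel′ k A) → ∀ j → k < toℕ j → is-just (A j) ≡ false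
  level-free {k} h j k<j = Equivalence.to T-not-≡
    (if-true⁻ (ℕₚ.<⇒<ᵇ k<j)
      (if-false⁻ (ℕₚ.<⇒≢ k<j ∘ sym ∘ ℕₚ.≡ᵇ⇒≡ (toℕ j) k) (all-allFin⁻ _ h j)))

  level-atMostOne : ∀ {k A} → k < n → T (inLevel′ k A) → (x : Pt s k) →
                    AtMostOne (λ y → member (suc k) A (x , y))
  level-atMostOne {k} {A} k<n h x =
    member-atMostOne A j x (Finₚ.toℕ-fromℕ< k<n) (level-fixed h j (Finₚ.toℕ-fromℕ< k<n))
    where j = fromℕ< k<n

  fixedCoords : (k : ℕ) → Hyp s n → Subset k
  fixedCoords k A = tabulate (λ i → fixedAt A (toℕ i))

  fixedCoords-injective : ∀ {k A B} → T (inLevel′ k A) → T (inLevel′ k B) →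
                          fixedCoords k A ≡ fixedCoords k B → Parallel s A B
  fixedCoords-injective {k} {A} {B} hA hB same j with ℕₚ.<-cmp (toℕ j) k
  ... | tri< j<k _ _ = begin
    is-just (A j)               ≡⟨ sym (fixedAt-toℕ A j) ⟩
    fixedAt A (toℕ j)           ≡⟨ ≡.cong (fixedAt A) (sym toℕi≡toℕj) ⟩
    fixedAt A (toℕ i)           ≡⟨ sym (Vecₚ.lookup∘tabulate _ i) ⟩
    lookup (fixedCoords k A) i  ≡⟨ ≡.cong (λ J → lookup J i) same ⟩
    lookup (fixedCoords k B) i  ≡⟨ Vecₚ.lookup∘tabulate _ i ⟩
    fixedAt B (toℕ i)           ≡⟨ ≡.cong (fixedAt B) toℕi≡toℕj ⟩
    fixedAt B (toℕ j)           ≡⟨ fixedAt-toℕ B j ⟩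
    is-just (B j)               ∎
    where
    open ≡-Reasoning
    i = fromℕ< j<k
    toℕi≡toℕj = Finₚ.toℕ-fromℕ< j<k
  ... | tri≈ _ j≡k _ = trans (Equivalence.to T-≡ (level-fixed hA j j≡k))
                             (sym (Equivalence.to T-≡ (level-fixed hB j j≡k)))
  ... | tri> _ _ k<j = trans (level-free hA j k<j) (sym (level-free hB j k<j))

module Reweighting (δ : ℚ) (0≤δ : 0ℚ ℚ.≤ δ) (δ<1 : δ ℚ.< 1ℚ) where

  weightIn weightOut : ℚ → ℚ
  weightIn  a = 0ℚ ⊔ ((a - δ) ÷' (a * (1ℚ - δ)))
  weightOut a = (1ℚ ÷' (1ℚ - a)) ⊓ (1ℚ ÷' (1ℚ - δ))

  0<1-δ : 0ℚ ℚ.< 1ℚ - δ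
  0<1-δ = p<q⇒0<q-p δ<1

  1-δ≢0 : 1ℚ - δ ≢ 0ℚ
  1-δ≢0 = ℚₚ.<⇒≢ 0<1-δ ∘ sym

  0≤1÷'[1-δ] : 0ℚ ℚ.≤ 1ℚ ÷' (1ℚ - δ)
  0≤1÷'[1-δ] = ÷'-nonNeg 0≤1 (ℚₚ.<⇒≤ 0<1-δ)

  weightIn-nonNeg : ∀ a → 0ℚ ℚ.≤ weightIn a
  weightIn-nonNeg a = ℚₚ.p≤p⊔q 0ℚ ((a - δ) ÷' (a * (1ℚ - δ)))

  weightOut-nonNeg : ∀ {a} → a ℚ.≤ 1ℚ → 0ℚ ℚ.≤ weightOut a
  weightOut-nonNeg a≤1 = ℚₚ.⊓-glb (÷'-nonNeg 0≤1 (p≤q⇒0≤q-p a≤1)) 0≤1÷'[1-δ]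

  weightIn-≤ : ∀ {a} → 0ℚ ℚ.≤ a → weightIn a ℚ.≤ 1ℚ ÷' (1ℚ - δ)
  weightIn-≤ {a} 0≤a = ℚₚ.⊔-lub 0≤1÷'[1-δ]
    (÷'-≤ (*-nonNeg 0≤a (ℚₚ.<⇒≤ 0<1-δ)) 0≤1÷'[1-δ] (begin
      a - δ                              ≤⟨ 0≤q⇒p-q≤p 0≤δ ⟩
      a                                  ≡⟨ sym (ℚₚ.*-identityʳ a) ⟩
      a * 1ℚ                             ≡⟨ ≡.cong (a *_) (sym (*-÷'-cancel 1ℚ 1-δ≢0)) ⟩
      a * ((1ℚ - δ) * (1ℚ ÷' (1ℚ - δ)))  ≡⟨ sym (ℚₚ.*-assoc a _ _) ⟩
      a * (1ℚ - δ) * (1ℚ ÷' (1ℚ - δ))    ∎))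
    where open ≤-Reasoning

  weightOut-≤ : ∀ a → weightOut a ℚ.≤ 1ℚ ÷' (1ℚ - δ)
  weightOut-≤ a = ℚₚ.p⊓q≤q (1ℚ ÷' (1ℚ - a)) (1ℚ ÷' (1ℚ - δ))

  ratio-average≡1 : ∀ a → a * (1ℚ - δ) ≢ 0ℚ →
                    (a - δ) ÷' (a * (1ℚ - δ)) * a + (1ℚ ÷' (1ℚ - δ)) * (1ℚ - a) ≡ 1ℚ
  ratio-average≡1 a a[1-δ]≢0 = *-cancelˡ-≢0 1-δ≢0 (begin
    (1ℚ - δ) * (q * a + i * (1ℚ - a))
      ≡⟨ solve 4 (λ u q a i → u :* (q :* a :+ i :* (con 1ℚ :- a)) := a :* u :* q :+ u :* i :* (con 1ℚ :- a))
                 refl (1ℚ - δ) q a i ⟩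
    a * (1ℚ - δ) * q + (1ℚ - δ) * i * (1ℚ - a)
      ≡⟨ cong₂ (λ x y → x + y * (1ℚ - a)) (*-÷'-cancel (a - δ) a[1-δ]≢0) (*-÷'-cancel 1ℚ 1-δ≢0) ⟩
    a - δ + 1ℚ * (1ℚ - a)
      ≡⟨ solve 2 (λ a d → a :- d :+ con 1ℚ :* (con 1ℚ :- a) := (con 1ℚ :- d) :* con 1ℚ) refl a δ ⟩
    (1ℚ - δ) * 1ℚ ∎)
    where
    open ≡-Reasoning
    q = (a - δ) ÷' (a * (1ℚ - δ))
    i = 1ℚ ÷' (1ℚ - δ)

  weight-average-≤-1 : ∀ {a} → 0ℚ ℚ.≤ a → a ℚ.≤ 1ℚ → weightIn a * a + weightOut a * (1ℚ - a) ℚ.≤ 1ℚ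
  weight-average-≤-1 {a} 0≤a a≤1 with a ℚₚ.≤? δ
  ... | yes a≤δ = begin
    weightIn a * a + weightOut a * (1ℚ - a)
      ≡⟨ ≡.cong (λ w → w * a + weightOut a * (1ℚ - a)) weightIn≡0 ⟩
    0ℚ * a + weightOut a * (1ℚ - a)
      ≡⟨ solve 3 (λ a w b → con 0ℚ :* a :+ w :* b := w :* b) refl a (weightOut a) (1ℚ - a) ⟩
    weightOut a * (1ℚ - a)
      ≤⟨ *-monoʳ-≤ (ℚₚ.<⇒≤ 0<1-a) (ℚₚ.p⊓q≤p (1ℚ ÷' (1ℚ - a)) (1ℚ ÷' (1ℚ - δ))) ⟩
    (1ℚ ÷' (1ℚ - a)) * (1ℚ - a)
      ≡⟨ ℚₚ.*-comm (1ℚ ÷' (1ℚ - a)) (1ℚ - a) ⟩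
    (1ℚ - a) * (1ℚ ÷' (1ℚ - a))
      ≡⟨ *-÷'-cancel 1ℚ (ℚₚ.<⇒≢ 0<1-a ∘ sym) ⟩
    1ℚ ∎
    where
    open ≤-Reasoning
    0<1-a : 0ℚ ℚ.< 1ℚ - a
    0<1-a = p<q⇒0<q-p (ℚₚ.≤-<-trans a≤δ δ<1)
    weightIn≡0 : weightIn a ≡ 0ℚ
    weightIn≡0 = ℚₚ.p≥q⇒p⊔q≡p (÷'-≤ (*-nonNeg 0≤a (ℚₚ.<⇒≤ 0<1-δ)) ℚₚ.≤-refl
                   (subst (a - δ ℚ.≤_) (sym (ℚₚ.*-zeroʳ (a * (1ℚ - δ)))) (p≤q⇒p-q≤0 a≤δ)))
  ... | no a≰δ = begin
    weightIn a * a + weightOut a * (1ℚ - a)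
      ≡⟨ ≡.cong (λ w → w * a + weightOut a * (1ℚ - a)) weightIn≡ratio ⟩
    ratio * a + weightOut a * (1ℚ - a)
      ≤⟨ ℚₚ.+-monoʳ-≤ (ratio * a) (*-monoʳ-≤ (p≤q⇒0≤q-p a≤1) (weightOut-≤ a)) ⟩
    ratio * a + (1ℚ ÷' (1ℚ - δ)) * (1ℚ - a)
      ≡⟨ ratio-average≡1 a (ℚₚ.<⇒≢ 0<a[1-δ] ∘ sym) ⟩
    1ℚ ∎
    where
    open ≤-Reasoning
    ratio = (a - δ) ÷' (a * (1ℚ - δ))
    δ<a : δ ℚ.< a
    δ<a = ℚₚ.≰⇒> a≰δ
    0<a[1-δ] : 0ℚ ℚ.< a * (1ℚ - δ)
    0<a[1-δ] = *-pos (ℚₚ.≤-<-trans 0≤δ δ<a) 0<1-δ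
    weightIn≡ratio : weightIn a ≡ ratio
    weightIn≡ratio = ℚₚ.p≤q⇒p⊔q≡q (÷'-nonNeg (p≤q⇒0≤q-p (ℚₚ.<⇒≤ δ<a)) (ℚₚ.<⇒≤ 0<a[1-δ]))

module Measure (s : ℕ → ℕ) (n : ℕ) (δ : ℚ) (𝒜 : List (Hyp s n))
               (0≤δ : 0ℚ ℚ.≤ δ) (δ<1 : δ ℚ.< 1ℚ) where

  open Hyperplanes s n δ 𝒜
  open Reweighting δ 0≤δ δ<1

  α′ : (k : ℕ) → Pt s k → ℚ
  α′ = α s n δ 𝒜

  ℙ′ : (k : ℕ) → Pt s k → ℚ
  ℙ′ = ℙ s n δ 𝒜

  inB′ : (k : ℕ) → Pt s (suc k) → Bool
  inB′ = inB s n δ 𝒜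

  α-nonNeg : ∀ k x → 0ℚ ℚ.≤ α′ k x
  α-nonNeg k x = average-𝟙-nonNeg (s k) (λ y → inB′ k (x , y))

  α-≤-1 : ∀ k x → α′ k x ℚ.≤ 1ℚ
  α-≤-1 k x = average-𝟙-≤-1 (s k) (λ y → inB′ k (x , y))

  weight : (k : ℕ) → Pt s k → Bool → ℚ
  weight k x b = if b then weightIn (α′ k x) else weightOut (α′ k x)

  weight-nonNeg : ∀ k x b → 0ℚ ℚ.≤ weight k x b
  weight-nonNeg k x true  = weightIn-nonNeg (α′ k x)
  weight-nonNeg k x false = weightOut-nonNeg (α-≤-1 k x)

  weight-≤ : ∀ k x b → weight k x b ℚ.≤ 1ℚ ÷' (1ℚ - δ)
  weight-≤ k x true  = weightIn-≤ (α-nonNeg k x)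
  weight-≤ k x false = weightOut-≤ (α′ k x)

  ℙ-nonNeg : ∀ k x → 0ℚ ℚ.≤ ℙ′ k x
  ℙ-nonNeg zero    _       = 0≤1
  ℙ-nonNeg (suc k) (x , y) = *-nonNeg (weight-nonNeg k x (inB′ k (x , y)))
                                      (÷'-nonNeg (ℙ-nonNeg k x) (ℕ→ℚ-nonNeg (s k)))

  sumFin-weight : ∀ k x → let a = α′ k x in
                  sumFin (s k) (λ y → weight k x (inB′ k (x , y)))
                    ≡ ℕ→ℚ (s k) * (weightIn a * a + weightOut a * (1ℚ - a))
  sumFin-weight k x = begin
    sumFin (s k) (λ y → weight k x (b y))
      ≡⟨ SumFin.cong (s k) (λ y → if-as-𝟙 (b y) u v) ⟩
    sumFin (s k) (λ y → v + (u - v) * 𝟙 (b y))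
      ≡⟨ SumFin.+-homo (s k) (λ _ → v) (λ y → (u - v) * 𝟙 (b y)) ⟩
    sumFin (s k) (λ _ → v) + sumFin (s k) (λ y → (u - v) * 𝟙 (b y))
      ≡⟨ cong₂ _+_ (sumFin-const (s k) v) (SumFin.*-homo (s k) (u - v) (λ y → 𝟙 (b y))) ⟩
    σ * v + (u - v) * sumFin (s k) (λ y → 𝟙 (b y))
      ≡⟨ ≡.cong (λ c → σ * v + (u - v) * c) (sym (ℕ→ℚ-*-average (s k) (λ y → 𝟙 (b y)))) ⟩
    σ * v + (u - v) * (σ * a)
      ≡⟨ solve 4 (λ σ u v a → σ :* v :+ (u :- v) :* (σ :* a) := σ :* (u :* a :+ v :* (con 1ℚ :- a))) refl σ u v a ⟩
    σ * (u * a + v * (1ℚ - a)) ∎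
    where
    open ≡-Reasoning
    a = α′ k x
    u = weightIn a
    v = weightOut a
    σ = ℕ→ℚ (s k)
    b : Fin (s k) → Bool
    b y = inB′ k (x , y)

  ℙ-suc-fibre-≤ : ∀ k x → sumFin (s k) (λ y → ℙ′ (suc k) (x , y)) ℚ.≤ ℙ′ k x
  ℙ-suc-fibre-≤ k x = begin
    sumFin (s k) (λ y → weight k x (inB′ k (x , y)) * d)
      ≡⟨ SumFin.*ʳ-homo (s k) d (λ y → weight k x (inB′ k (x , y))) ⟩
    sumFin (s k) (λ y → weight k x (inB′ k (x , y))) * d
      ≡⟨ ≡.cong (_* d) (sumFin-weight k x) ⟩
    σ * K * d
      ≡⟨ solve 3 (λ σ K d → σ :* K :* d := K :* (σ :* d)) refl σ K d ⟩
    K * (σ * d)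
      ≤⟨ *-monoʳ-≤ 0≤σd (weight-average-≤-1 (α-nonNeg k x) (α-≤-1 k x)) ⟩
    1ℚ * (σ * d)
      ≡⟨ ℚₚ.*-identityˡ (σ * d) ⟩
    σ * d
      ≤⟨ *-÷'-≤ (ℙ-nonNeg k x) (ℕ→ℚ-nonNeg (s k)) ⟩
    ℙ′ k x ∎
    where
    open ≤-Reasoning
    a = α′ k x
    K = weightIn a * a + weightOut a * (1ℚ - a)
    σ = ℕ→ℚ (s k)
    d = ℙ′ k x ÷' σ
    0≤σd : 0ℚ ℚ.≤ σ * d
    0≤σd = *-nonNeg (ℕ→ℚ-nonNeg (s k)) (÷'-nonNeg (ℙ-nonNeg k x) (ℕ→ℚ-nonNeg (s k)))

  pointFactor : ℕ → ℚ
  pointFactor t = 1ℚ ÷' ((1ℚ - δ) * ℕ→ℚ (s t))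

  pointFactor-nonNeg : ∀ t → 0ℚ ℚ.≤ pointFactor t
  pointFactor-nonNeg t = ÷'-nonNeg 0≤1 (*-nonNeg (ℚₚ.<⇒≤ 0<1-δ) (ℕ→ℚ-nonNeg (s t)))

  ℙ-suc-point-≤ : ∀ k x y → ℙ′ (suc k) (x , y) ℚ.≤ pointFactor k * ℙ′ k x
  ℙ-suc-point-≤ k x y = begin
    weight k x (inB′ k (x , y)) * (P ÷' σ)
      ≤⟨ *-monoʳ-≤ (÷'-nonNeg (ℙ-nonNeg k x) (ℕ→ℚ-nonNeg (s k))) (weight-≤ k x (inB′ k (x , y))) ⟩
    (1ℚ ÷' (1ℚ - δ)) * (P ÷' σ)
      ≡⟨ ≡.cong ((1ℚ ÷' (1ℚ - δ)) *_) (÷'≡*1÷' P σ) ⟩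
    (1ℚ ÷' (1ℚ - δ)) * (P * (1ℚ ÷' σ))
      ≡⟨ solve 3 (λ i P j → i :* (P :* j) := i :* j :* P) refl (1ℚ ÷' (1ℚ - δ)) P (1ℚ ÷' σ) ⟩
    (1ℚ ÷' (1ℚ - δ)) * (1ℚ ÷' σ) * P
      ≡⟨ ≡.cong (_* P) (sym (1÷'-* (1ℚ - δ) σ)) ⟩
    pointFactor k * P ∎
    where
    open ≤-Reasoning
    P = ℙ′ k x
    σ = ℕ→ℚ (s k)

  module _ (k : ℕ) (x : Pt s k) (Z : Fin (s k) → Bool) (Z′ : Bool) (Z⇒Z′ : ∀ y → T (Z y) → T Z′) where

    fibreMass-≤ : sumFin (s k) (λ y → 𝟙 (Z y) * ℙ′ (suc k) (x , y)) ℚ.≤ 𝟙 Z′ * ℙ′ k x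
    fibreMass-≤ = begin
      sumFin (s k) (λ y → 𝟙 (Z y) * ℙ′ (suc k) (x , y))
        ≤⟨ SumFin.mono (s k) (λ y → *-monoʳ-≤ (ℙ-nonNeg (suc k) (x , y)) (𝟙-mono (Z⇒Z′ y))) ⟩
      sumFin (s k) (λ y → 𝟙 Z′ * ℙ′ (suc k) (x , y))
        ≡⟨ SumFin.*-homo (s k) (𝟙 Z′) (λ y → ℙ′ (suc k) (x , y)) ⟩
      𝟙 Z′ * sumFin (s k) (λ y → ℙ′ (suc k) (x , y))
        ≤⟨ *-monoˡ-≤ (𝟙-nonNeg Z′) (ℙ-suc-fibre-≤ k x) ⟩
      𝟙 Z′ * ℙ′ k x ∎
      where open ≤-Reasoning

    fibreMass-≤-atMostOne : AtMostOne Z →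
      sumFin (s k) (λ y → 𝟙 (Z y) * ℙ′ (suc k) (x , y)) ℚ.≤ pointFactor k * (𝟙 Z′ * ℙ′ k x)
    fibreMass-≤-atMostOne atMostOne = begin
      sumFin (s k) (λ y → 𝟙 (Z y) * ℙ′ (suc k) (x , y))
        ≤⟨ SumFin.mono (s k) (λ y → *-monoˡ-≤ (𝟙-nonNeg (Z y)) (ℙ-suc-point-≤ k x y)) ⟩
      sumFin (s k) (λ y → 𝟙 (Z y) * (pointFactor k * P))
        ≡⟨ SumFin.*ʳ-homo (s k) (pointFactor k * P) (λ y → 𝟙 (Z y)) ⟩
      sumFin (s k) (λ y → 𝟙 (Z y)) * (pointFactor k * P)
        ≤⟨ *-monoʳ-≤ (*-nonNeg (pointFactor-nonNeg k) (ℙ-nonNeg k x)) (sumFin-𝟙-≤ (s k) atMostOne Z⇒Z′) ⟩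
      𝟙 Z′ * (pointFactor k * P)
        ≡⟨ solve 3 (λ i c P → i :* (c :* P) := c :* (i :* P)) refl (𝟙 Z′) (pointFactor k) P ⟩
      pointFactor k * (𝟙 Z′ * P) ∎
      where
      open ≤-Reasoning
      P = ℙ′ k x

  inBoth : (k : ℕ) → Hyp s n → Hyp s n → Pt s k → Bool
  inBoth k A B x = member k A x ∧ member k B x

  inBoth⇒memberˡ : ∀ k A B (x : Pt s k) → T (inBoth k A B x) → T (member k A x)
  inBoth⇒memberˡ k A B x = proj₁ ∘ Equivalence.to T-∧

  inBoth⇒memberʳ : ∀ k A B (x : Pt s k) → T (inBoth k A B x) → T (member k B x)
  inBoth⇒memberʳ k A B x = proj₂ ∘ Equivalence.to T-∧

  inBoth-init : ∀ k A B (x : Pt s k) y → T (inBoth (suc k) A B (x , y)) → T (inBoth k A B x)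
  inBoth-init k A B x y h = Equivalence.from T-∧
    ( member-init k A x y (inBoth⇒memberˡ (suc k) A B (x , y) h)
    , member-init k B x y (inBoth⇒memberʳ (suc k) A B (x , y) h))

  νFactor : Hyp s n → Hyp s n → ℕ → ℚ
  νFactor A B t = if fixedAt A t ∨ fixedAt B t then pointFactor t else 1ℚ

  νFactor-nonNeg : ∀ A B t → 0ℚ ℚ.≤ νFactor A B t
  νFactor-nonNeg A B t with fixedAt A t ∨ fixedAt B t
  ... | true  = pointFactor-nonNeg t
  ... | false = 0≤1

  ν-fixedCoords : ∀ k A B → ν s n δ 𝒜 k (fixedCoords k A ∪ fixedCoords k B) ≡ prodFin k (λ i → νFactor A B (toℕ i))
  ν-fixedCoords k A B = prodFin-cong k (λ i → ≡.cong (λ b → if b then pointFactor (toℕ i) else 1ℚ)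
    (trans (Vecₚ.lookup-zipWith _∨_ i (fixedCoords k A) (fixedCoords k B))
           (cong₂ _∨_ (Vecₚ.lookup∘tabulate _ i) (Vecₚ.lookup∘tabulate _ i))))

  ν-nonNeg : ∀ k J → 0ℚ ℚ.≤ ν s n δ 𝒜 k J
  ν-nonNeg k J = prodFin-nonNeg k (λ i → factor-nonNeg (lookup J i) (toℕ i))
    where
    factor-nonNeg : ∀ b t → 0ℚ ℚ.≤ (if b then pointFactor t else 1ℚ)
    factor-nonNeg true  t = pointFactor-nonNeg t
    factor-nonNeg false t = 0≤1

  fibreMass-inBoth-≤ : ∀ k A B x →
    sumFin (s k) (λ y → 𝟙 (inBoth (suc k) A B (x , y)) * ℙ′ (suc k) (x , y))
      ℚ.≤ νFactor A B k * (𝟙 (inBoth k A B x) * ℙ′ k x)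
  fibreMass-inBoth-≤ k A B x with fixedAt A k in fixedA | fixedAt B k in fixedB
  ... | true  | _     = fibreMass-≤-atMostOne k x Z (inBoth k A B x) (inBoth-init k A B x)
                          (atMostOne-⊆ (λ y → inBoth⇒memberˡ (suc k) A B (x , y))
                                       (fixedAt-atMostOne A x (subst T (sym fixedA) _)))
    where Z = λ y → inBoth (suc k) A B (x , y)
  ... | false | true  = fibreMass-≤-atMostOne k x Z (inBoth k A B x) (inBoth-init k A B x)
                          (atMostOne-⊆ (λ y → inBoth⇒memberʳ (suc k) A B (x , y))
                                       (fixedAt-atMostOne B x (subst T (sym fixedB) _)))
    where Z = λ y → inBoth (suc k) A B (x , y)
  ... | false | false = ℚₚ.≤-trans
                          (fibreMass-≤ k x (λ y → inBoth (suc k) A B (x , y)) (inBoth k A B x) (inBoth-init k A B x))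
                          (ℚₚ.≤-reflexive (sym (ℚₚ.*-identityˡ _)))

  ℙ-inBoth-≤ : ∀ k A B → sumPt s k (λ x → 𝟙 (inBoth k A B x) * ℙ′ k x) ℚ.≤ prodFin k (λ i → νFactor A B (toℕ i))
  ℙ-inBoth-≤ zero    A B = ℚₚ.≤-trans (ℚₚ.≤-reflexive (ℚₚ.*-identityʳ _)) (𝟙-≤-1 (inBoth zero A B _))
  ℙ-inBoth-≤ (suc k) A B = begin
    sumPt s k (λ x → sumFin (s k) (λ y → 𝟙 (inBoth (suc k) A B (x , y)) * ℙ′ (suc k) (x , y)))
      ≤⟨ SumPt.mono s k (fibreMass-inBoth-≤ k A B) ⟩
    sumPt s k (λ x → νFactor A B k * (𝟙 (inBoth k A B x) * ℙ′ k x))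
      ≡⟨ SumPt.*-homo s k (νFactor A B k) (λ x → 𝟙 (inBoth k A B x) * ℙ′ k x) ⟩
    νFactor A B k * sumPt s k (λ x → 𝟙 (inBoth k A B x) * ℙ′ k x)
      ≤⟨ *-monoˡ-≤ (νFactor-nonNeg A B k) (ℙ-inBoth-≤ k A B) ⟩
    νFactor A B k * prodFin k (λ i → νFactor A B (toℕ i))
      ≡⟨ ℚₚ.*-comm (νFactor A B k) _ ⟩
    prodFin k (λ i → νFactor A B (toℕ i)) * νFactor A B k
      ≡⟨ sym (prodFin-toℕ-suc k (νFactor A B)) ⟩
    prodFin (suc k) (λ i → νFactor A B (toℕ i)) ∎
    where open ≤-Reasoning

  levelHyps : ℕ → List (Hyp s n)
  levelHyps k = filterᵇ (inLevel′ k) 𝒜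

  levelHyps-inLevel : ∀ k → All (T ∘ inLevel′ k) (levelHyps k)
  levelHyps-inLevel k = all-filter (T? ∘ inLevel′ k) 𝒜

  levelHyps-distinct : ∀ k → AllPairs (λ A A′ → ¬ Parallel s A A′) 𝒜 →
                       AllPairs (λ A B → fixedCoords k A ≢ fixedCoords k B) (levelHyps k)
  levelHyps-distinct k nonParallel =
    allPairs-under-All (λ levA levB A∦B → A∦B ∘ fixedCoords-injective levA levB)
                       (levelHyps-inLevel k) (AllPairs.filter⁺ (T? ∘ inLevel′ k) nonParallel)

  cover : (k : ℕ) → Pt s k → ℚ
  cover k x = sumList (levelHyps k) (λ A → 𝟙 (member k A x))

  count-≤-cover : ∀ {k} → k < n → ∀ x → sumFin (s k) (λ y → 𝟙 (inB′ k (x , y))) ℚ.≤ cover k x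
  count-≤-cover {k} k<n x = begin
    sumFin (s k) (λ y → 𝟙 (inB′ k (x , y)))
      ≤⟨ SumFin.mono (s k) (λ y → 𝟙-any-≤ (λ A → inLevel′ k A ∧ member (suc k) A (x , y)) 𝒜) ⟩
    sumFin (s k) (λ y → sumList 𝒜 (λ A → 𝟙 (inLevel′ k A ∧ member (suc k) A (x , y))))
      ≡⟨ SumFin.cong (s k) (λ y → trans (SumList.cong 𝒜 (λ A → 𝟙-∧ (inLevel′ k A) _))
                                        (sym (sumList-filterᵇ (inLevel′ k) 𝒜 (λ A → 𝟙 (member (suc k) A (x , y)))))) ⟩
    sumFin (s k) (λ y → sumList (levelHyps k) (λ A → 𝟙 (member (suc k) A (x , y))))
      ≡⟨ SumFin.swap-sumList (s k) (levelHyps k) (λ y A → 𝟙 (member (suc k) A (x , y))) ⟩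
    sumList (levelHyps k) (λ A → sumFin (s k) (λ y → 𝟙 (member (suc k) A (x , y))))
      ≤⟨ sumList-mono-All (All.map (λ {A} levA → sumFin-𝟙-≤ (s k) (level-atMostOne k<n levA x) (member-init k A x))
                                   (levelHyps-inLevel k)) ⟩
    cover k x ∎
    where open ≤-Reasoning

  α²ℙ-≤ : ∀ {k} → k < n → ∀ x →
          α′ k x * α′ k x * ℙ′ k x ℚ.≤ (1ℚ ÷' (ℕ→ℚ (s k) * ℕ→ℚ (s k))) * (cover k x * cover k x * ℙ′ k x)
  α²ℙ-≤ {k} k<n x = begin
    α′ k x * α′ k x * P            ≤⟨ *-monoʳ-≤ (ℙ-nonNeg k x) (*-self-mono-≤ (α-nonNeg k x) α≤Mi) ⟩
    M * i * (M * i) * P            ≡⟨ solve 3 (λ M i P → M :* i :* (M :* i) :* P := i :* i :* (M :* M :* P)) refl M i P ⟩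
    i * i * (M * M * P)            ≡⟨ ≡.cong (_* (M * M * P)) (sym (1÷'-* σ σ)) ⟩
    (1ℚ ÷' (σ * σ)) * (M * M * P)  ∎
    where
    open ≤-Reasoning
    P = ℙ′ k x
    M = cover k x
    σ = ℕ→ℚ (s k)
    i = 1ℚ ÷' σ
    α≤Mi : α′ k x ℚ.≤ M * i
    α≤Mi = ℚₚ.≤-trans (ℚₚ.≤-reflexive (÷'≡*1÷' _ σ))
                      (*-monoʳ-≤ (÷'-nonNeg 0≤1 (ℕ→ℚ-nonNeg (s k))) (count-≤-cover k<n x))

  sumPt-cover² : ∀ k → sumPt s k (λ x → cover k x * cover k x * ℙ′ k x)
                       ≡ sumList (levelHyps k) (λ A → sumList (levelHyps k) (λ B →
                           sumPt s k (λ x → 𝟙 (inBoth k A B x) * ℙ′ k x)))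
  sumPt-cover² k = begin
    sumPt s k (λ x → cover k x * cover k x * ℙ′ k x)
      ≡⟨ SumPt.cong s k expand ⟩
    sumPt s k (λ x → sumList L (λ A → sumList L (λ B → 𝟙 (inBoth k A B x) * ℙ′ k x)))
      ≡⟨ SumPt.swap-sumList s k L (λ x A → sumList L (λ B → 𝟙 (inBoth k A B x) * ℙ′ k x)) ⟩
    sumList L (λ A → sumPt s k (λ x → sumList L (λ B → 𝟙 (inBoth k A B x) * ℙ′ k x)))
      ≡⟨ SumList.cong L (λ A → SumPt.swap-sumList s k L (λ x B → 𝟙 (inBoth k A B x) * ℙ′ k x)) ⟩
    sumList L (λ A → sumList L (λ B → sumPt s k (λ x → 𝟙 (inBoth k A B x) * ℙ′ k x))) ∎
    where
    open ≡-Reasoning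
    L = levelHyps k
    m : Pt s k → Hyp s n → ℚ
    m x A = 𝟙 (member k A x)
    expand : ∀ x → cover k x * cover k x * ℙ′ k x
                   ≡ sumList L (λ A → sumList L (λ B → 𝟙 (inBoth k A B x) * ℙ′ k x))
    expand x = begin
      cover k x * cover k x * ℙ′ k x
        ≡⟨ ≡.cong (_* ℙ′ k x) (SumList.product-of-sums L (m x) (m x)) ⟩
      sumList L (λ A → sumList L (λ B → m x A * m x B)) * ℙ′ k x
        ≡⟨ sym (SumList.*ʳ-homo L (ℙ′ k x) _) ⟩
      sumList L (λ A → sumList L (λ B → m x A * m x B) * ℙ′ k x)
        ≡⟨ SumList.cong L (λ A → sym (SumList.*ʳ-homo L (ℙ′ k x) _)) ⟩
      sumList L (λ A → sumList L (λ B → m x A * m x B * ℙ′ k x))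
        ≡⟨ SumList.cong L (λ A → SumList.cong L (λ B →
             ≡.cong (_* ℙ′ k x) (sym (𝟙-∧ (member k A x) (member k B x))))) ⟩
      sumList L (λ A → sumList L (λ B → 𝟙 (inBoth k A B x) * ℙ′ k x)) ∎

  𝔼α²-≤-rhs : ∀ {k} → k < n → AllPairs (λ A A′ → ¬ Parallel s A A′) 𝒜 → 𝔼α² s n δ 𝒜 k ℚ.≤ rhs s n δ 𝒜 k
  𝔼α²-≤-rhs {k} k<n nonParallel = begin
    sumPt s k (λ x → α′ k x * α′ k x * ℙ′ k x)
      ≤⟨ SumPt.mono s k (α²ℙ-≤ k<n) ⟩
    sumPt s k (λ x → i² * (cover k x * cover k x * ℙ′ k x))
      ≡⟨ SumPt.*-homo s k i² (λ x → cover k x * cover k x * ℙ′ k x) ⟩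
    i² * sumPt s k (λ x → cover k x * cover k x * ℙ′ k x)
      ≡⟨ ≡.cong (i² *_) (sumPt-cover² k) ⟩
    i² * sumList L (λ A → sumList L (λ B → sumPt s k (λ x → 𝟙 (inBoth k A B x) * ℙ′ k x)))
      ≤⟨ *-monoˡ-≤ 0≤i² (SumList.mono L (λ A → SumList.mono L (λ B →
           ℚₚ.≤-trans (ℙ-inBoth-≤ k A B) (ℚₚ.≤-reflexive (sym (ν-fixedCoords k A B)))))) ⟩
    i² * sumList L (λ A → sumList L (λ B → ν s n δ 𝒜 k (F A ∪ F B)))
      ≤⟨ *-monoˡ-≤ 0≤i² (sumList²-≤-sumSubsets² k F (levelHyps-distinct k nonParallel)
                           (λ J₁ J₂ → ν s n δ 𝒜 k (J₁ ∪ J₂)) (λ J₁ J₂ → ν-nonNeg k (J₁ ∪ J₂))) ⟩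
    i² * sumSubsets k (λ J₁ → sumSubsets k (λ J₂ → ν s n δ 𝒜 k (J₁ ∪ J₂))) ∎
    where
    open ≤-Reasoning
    L = levelHyps k
    F = fixedCoords k
    i² = 1ℚ ÷' (ℕ→ℚ (s k) * ℕ→ℚ (s k))
    0≤i² : 0ℚ ℚ.≤ i²
    0≤i² = ÷'-nonNeg 0≤1 (*-nonNeg (ℕ→ℚ-nonNeg (s k)) (ℕ→ℚ-nonNeg (s k)))

-- Neither 1 ≤ n nor |S_j| ≥ 2 is needed (every quotient above is also right for a zero
-- denominator, via the junk value of ÷'), and δ ≤ ½ is only used as δ < 1.
lemma4p3 : (n : ℕ) → 1 ≤ n → (s : ℕ → ℕ) → ((j : Fin n) → 2 ≤ s (toℕ j))
    → (δ : ℚ) → 0ℚ ℚ.≤ δ → δ ℚ.≤ ½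
    → (𝒜 : List (Hyp s n)) → AllPairs (λ A A′ → ¬ Parallel s A A′) 𝒜
    → (k : ℕ) → k < n
    → 𝔼α² s n δ 𝒜 k ℚ.≤ rhs s n δ 𝒜 k
lemma4p3 n _ s _ δ 0≤δ δ≤½ 𝒜 nonParallel k k<n =
  Measure.𝔼α²-≤-rhs s n δ 𝒜 0≤δ (ℚₚ.≤-<-trans δ≤½ ½<1) k<n nonParallel
  where
  ½<1 : ½ ℚ.< 1ℚ
  ½<1 = toWitness {a? = ½ ℚₚ.<? 1ℚ} _
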